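{- Let $L$ be an atomistic lattice, and let $C(L)=A(L)\cup\{0,1\}$ with the order inherited from $L$. Then a binary operation $T$ on $C(L)$ is a t-norm on $C(L)$ if and only if there exists a set $\alpha\subseteq A(L)$ such that $T=T_\alpha$, where $$T_\alpha(x,y)=\begin{cases} x\wedge y, & \text{if } x=1 \text{ or } y=1,\\ x, & \text{if } x=y\in\alpha,\\ 0, & \text{otherwise}.\end{cases}$$
   Context: A lattice $L$ with bottom $0$ and top $1$ is atomistic if every element of $L$ is the join of some set of atoms. An atom is an element covering $0$; $A(L)$ denotes the set of atoms of $L$. $C(L)=A(L)\cup\{0,1\}$ is regarded as a bounded poset with the order inherited from $L$ (it need not be a sublattice of $L$). A t-norm on a bounded poset $P$ with top $1$ is a binary operation $T:P\times P\to P$ that is monotone in each argument, commutative, associative, and has $1$ as neutral element ($T(x,1)=x$ for all $x$). -}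

module Defs where

open import Level using (Level; _⊔_)
open import Data.Product using (Σ; Σ-syntax; ∃; _×_; _,_; proj₁)
open import Data.Sum using (_⊎_)
open import Relation.Nullary using (¬_)
open import Relation.Unary using (Pred)
open import Relation.Binary.Lattice.Bundles using (BoundedLattice)

module _ {a ℓ₁ ℓ₂ : Level} (L : BoundedLattice a ℓ₁ ℓ₂) where
  open BoundedLattice L

  IsAtom : Carrier → Set (a ⊔ ℓ₁ ⊔ ℓ₂)
  IsAtom x = (¬ x ≈ ⊥) × (∀ y → y ≤ x → ¬ y ≈ ⊥ → y ≈ x)

  IsJoinOf : Pred Carrier a → Carrier → Set (a ⊔ ℓ₂)
  IsJoinOf S x = (∀ y → S y → y ≤ x) × (∀ z → (∀ y → S y → y ≤ z) → x ≤ z)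

  Atomistic : Set (Level.suc a ⊔ ℓ₁ ⊔ ℓ₂)
  Atomistic = ∀ x → Σ[ S ∈ Pred Carrier a ] ((∀ y → S y → IsAtom y) × IsJoinOf S x)

  InC : Carrier → Set (a ⊔ ℓ₁ ⊔ ℓ₂)
  InC x = IsAtom x ⊎ (x ≈ ⊥) ⊎ (x ≈ ⊤)

  C : Set (a ⊔ ℓ₁ ⊔ ℓ₂)
  C = Σ Carrier InC

  _≈C_ : C → C → Set ℓ₁
  x ≈C y = proj₁ x ≈ proj₁ y

  _≤C_ : C → C → Set ℓ₂
  x ≤C y = proj₁ x ≤ proj₁ y

  0C : C
  0C = ⊥ , Data.Sum.inj₂ (Data.Sum.inj₁ Eq.refl)

  1C : C
  1C = ⊤ , Data.Sum.inj₂ (Data.Sum.inj₂ Eq.refl)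

  IsTNorm : (C → C → C) → Set (a ⊔ ℓ₁ ⊔ ℓ₂)
  IsTNorm T =
      (∀ x x' y → x ≤C x' → T x y ≤C T x' y)
    × (∀ x y y' → y ≤C y' → T x y ≤C T x y')
    × (∀ x y → T x y ≈C T y x)
    × (∀ x y z → T (T x y) z ≈C T x (T y z))
    × (∀ x → T x 1C ≈C x)

  IsTα : Pred Carrier a → (C → C → C) → Set (a ⊔ ℓ₁ ⊔ ℓ₂)
  IsTα α T = ∀ x y →
      ((proj₁ x ≈ ⊤ ⊎ proj₁ y ≈ ⊤) → proj₁ (T x y) ≈ proj₁ x ∧ proj₁ y)
    × ((proj₁ x ≈ proj₁ y × α (proj₁ x)) → T x y ≈C x)
    × (¬ (proj₁ x ≈ ⊤ ⊎ proj₁ y ≈ ⊤) → ¬ (proj₁ x ≈ proj₁ y × α (proj₁ x)) → T x y ≈C 0C)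

  -- α ⊆ A(L), α a subset of the setoid (closed under ≈)
  AtomSet : Pred Carrier a → Set (a ⊔ ℓ₁ ⊔ ℓ₂)
  AtomSet α = (∀ x → α x → IsAtom x) × (∀ x y → x ≈ y → α x → α y)

{-# OPTIONS --safe #-}
-- C(L) has height two: an element of C(L) below an atom x is 0 or x, and two
-- distinct elements of C(L) other than 1 meet in 0.  A t-norm is bounded by
-- the meet, so away from 1 it vanishes off the diagonal, and at an atom x it
-- takes T(x,x) ∈ {0, x}; α is the set of atoms where T(x,x) = x.  Conversely,
-- every t-norm axiom for T_α reduces, case by case, to the same two facts.
-- Excluded middle decides the cases and resizes α to the level of the carrier.
module Submission where

open import Defs
open import Level using (Level; _⊔_; Lift; lift; lower)
open import Function using (_∘_)
open import Data.Product using (Σ-syntax; _×_; _,_; proj₁; proj₂)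
open import Data.Sum using (_⊎_; inj₁; inj₂; [_,_]; swap)
open import Data.Empty using (⊥-elim)
open import Relation.Nullary using (¬_; yes; no)
open import Relation.Nullary.Decidable using (True; toWitness; fromWitness)
open import Relation.Unary using (Pred)
open import Relation.Binary.Lattice.Bundles using (BoundedLattice)
open import Axiom.ExcludedMiddle using (ExcludedMiddle)

module Resizing (lem : ∀ {p} → ExcludedMiddle p) where

  Resized : ∀ {p} ℓ → Set p → Set ℓ
  Resized ℓ P = Lift ℓ (True (lem {P = P}))

  resize : ∀ {p ℓ} {P : Set p} → P → Resized ℓ P
  resize p = lift (fromWitness p)

  unresize : ∀ {p ℓ} {P : Set p} → Resized ℓ P → P
  unresize r = toWitness (lower r)

module HeightTwo {a ℓ₁ ℓ₂ : Level} (L : BoundedLattice a ℓ₁ ℓ₂) where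
  open BoundedLattice L
  open import Relation.Binary.Lattice.Properties.BoundedMeetSemilattice boundedMeetSemilattice
    using (identityˡ; identityʳ)
  open import Relation.Binary.Lattice.Properties.MeetSemilattice meetSemilattice using (∧-cong)

  ∧-identityˡ-≈⊤ : ∀ {x y} → x ≈ ⊤ → x ∧ y ≈ y
  ∧-identityˡ-≈⊤ {y = y} x≈⊤ = Eq.trans (∧-cong x≈⊤ Eq.refl) (identityˡ y)

  ∧-identityʳ-≈⊤ : ∀ {x y} → y ≈ ⊤ → x ∧ y ≈ x
  ∧-identityʳ-≈⊤ {x = x} y≈⊤ = Eq.trans (∧-cong Eq.refl y≈⊤) (identityʳ x)

  ≤⊥⇒≈⊥ : ∀ {x} → x ≤ ⊥ → x ≈ ⊥
  ≤⊥⇒≈⊥ x≤⊥ = antisym x≤⊥ (minimum _)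

  ≈⊥⇒≤ : ∀ {x y} → x ≈ ⊥ → x ≤ y
  ≈⊥⇒≤ x≈⊥ = trans (reflexive x≈⊥) (minimum _)

  ⊤≤⇒≈⊤ : ∀ {x} → ⊤ ≤ x → x ≈ ⊤
  ⊤≤⇒≈⊤ ⊤≤x = antisym (maximum _) ⊤≤x

  IsAtom-resp-≈ : ∀ {x y} → x ≈ y → IsAtom L x → IsAtom L y
  IsAtom-resp-≈ x≈y (x≉⊥ , below-x) =
    (λ y≈⊥ → x≉⊥ (Eq.trans x≈y y≈⊥)) ,
    (λ z z≤y z≉⊥ → Eq.trans (below-x z (trans z≤y (reflexive (Eq.sym x≈y))) z≉⊥) x≈y)

  nonTop⇒atom⊎⊥ : (x : C L) → ¬ proj₁ x ≈ ⊤ → IsAtom L (proj₁ x) ⊎ proj₁ x ≈ ⊥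
  nonTop⇒atom⊎⊥ (_ , inj₁ atom)      _   = inj₁ atom
  nonTop⇒atom⊎⊥ (_ , inj₂ (inj₁ ≈⊥)) _   = inj₂ ≈⊥
  nonTop⇒atom⊎⊥ (_ , inj₂ (inj₂ ≈⊤)) x≉⊤ = ⊥-elim (x≉⊤ ≈⊤)

  below-atom : ∀ {x} → IsAtom L x → (z : C L) → proj₁ z ≤ x → proj₁ z ≈ ⊥ ⊎ proj₁ z ≈ x
  below-atom (_ , below-x) (z , inj₁ (z≉⊥ , _)) z≤x = inj₂ (below-x z z≤x z≉⊥)
  below-atom _             (_ , inj₂ (inj₁ ≈⊥)) _   = inj₁ ≈⊥
  below-atom _             (_ , inj₂ (inj₂ ≈⊤)) z≤x =
    inj₂ (Eq.trans ≈⊤ (Eq.sym (⊤≤⇒≈⊤ (trans (reflexive (Eq.sym ≈⊤)) z≤x))))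

  atom-below-nonTop : ∀ {x} → IsAtom L x → (z : C L) → ¬ proj₁ z ≈ ⊤ → x ≤ proj₁ z → x ≈ proj₁ z
  atom-below-nonTop (x≉⊥ , _) z z≉⊤ x≤z with nonTop⇒atom⊎⊥ z z≉⊤
  ... | inj₁ (_ , below-z) = below-z _ x≤z x≉⊥
  ... | inj₂ z≈⊥           = ⊥-elim (x≉⊥ (≤⊥⇒≈⊥ (trans x≤z (reflexive z≈⊥))))

  module _ (lem : ∀ {p} → ExcludedMiddle p) where

    distinct-atoms-meet : ∀ {x y} → IsAtom L x → IsAtom L y → ¬ x ≈ y → x ∧ y ≈ ⊥
    distinct-atoms-meet {x} {y} (_ , below-x) (_ , below-y) x≉y with lem {P = x ∧ y ≈ ⊥}
    ... | yes x∧y≈⊥ = x∧y≈⊥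
    ... | no  x∧y≉⊥ = ⊥-elim (x≉y (Eq.trans (Eq.sym (below-x _ (x∧y≤x x y) x∧y≉⊥))
                                              (below-y _ (x∧y≤y x y) x∧y≉⊥)))

    distinct-nonTop-meet : (x y : C L) → ¬ proj₁ x ≈ ⊤ → ¬ proj₁ y ≈ ⊤ →
                           ¬ proj₁ x ≈ proj₁ y → proj₁ x ∧ proj₁ y ≈ ⊥
    distinct-nonTop-meet x y x≉⊤ y≉⊤ x≉y with nonTop⇒atom⊎⊥ x x≉⊤ | nonTop⇒atom⊎⊥ y y≉⊤
    ... | inj₂ x≈⊥    | _           = ≤⊥⇒≈⊥ (trans (x∧y≤x _ _) (reflexive x≈⊥))
    ... | _           | inj₂ y≈⊥    = ≤⊥⇒≈⊥ (trans (x∧y≤y _ _) (reflexive y≈⊥))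
    ... | inj₁ x-atom | inj₁ y-atom = distinct-atoms-meet x-atom y-atom x≉y

module Operation {a ℓ₁ ℓ₂ : Level} (L : BoundedLattice a ℓ₁ ℓ₂) (T : C L → C L → C L) where
  open BoundedLattice L

  Monotoneˡ : Set (a ⊔ ℓ₁ ⊔ ℓ₂)
  Monotoneˡ = ∀ x x' y → proj₁ x ≤ proj₁ x' → proj₁ (T x y) ≤ proj₁ (T x' y)

  Monotoneʳ : Set (a ⊔ ℓ₁ ⊔ ℓ₂)
  Monotoneʳ = ∀ x y y' → proj₁ y ≤ proj₁ y' → proj₁ (T x y) ≤ proj₁ (T x y')

  monotoneˡ⇒congˡ : Monotoneˡ → ∀ {x x'} y → proj₁ x ≈ proj₁ x' → proj₁ (T x y) ≈ proj₁ (T x' y)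
  monotoneˡ⇒congˡ mono y x≈x' =
    antisym (mono _ _ y (reflexive x≈x')) (mono _ _ y (reflexive (Eq.sym x≈x')))

  monotoneʳ⇒congʳ : Monotoneʳ → ∀ x {y y'} → proj₁ y ≈ proj₁ y' → proj₁ (T x y) ≈ proj₁ (T x y')
  monotoneʳ⇒congʳ mono x y≈y' =
    antisym (mono x _ _ (reflexive y≈y')) (mono x _ _ (reflexive (Eq.sym y≈y')))

  commutative∧monotoneˡ⇒monotoneʳ : (∀ x y → proj₁ (T x y) ≈ proj₁ (T y x)) → Monotoneˡ → Monotoneʳ
  commutative∧monotoneˡ⇒monotoneʳ comm mono x y y' y≤y' =
    trans (reflexive (comm x y)) (trans (mono y y' x y≤y') (reflexive (comm y' x)))

module TNorm⇒Tα (lem : ∀ {p} → ExcludedMiddle p) {a ℓ₁ ℓ₂ : Level} (L : BoundedLattice a ℓ₁ ℓ₂)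
                (T : C L → C L → C L) (isTNorm : IsTNorm L T) where
  open BoundedLattice L
  open Resizing lem
  open HeightTwo L
  open Operation L T

  private
    monoˡ : Monotoneˡ
    monoˡ = proj₁ isTNorm

    monoʳ : Monotoneʳ
    monoʳ = proj₁ (proj₂ isTNorm)

    comm : ∀ x y → proj₁ (T x y) ≈ proj₁ (T y x)
    comm = proj₁ (proj₂ (proj₂ isTNorm))

    identityʳ : ∀ x → proj₁ (T x (1C L)) ≈ proj₁ x
    identityʳ = proj₂ (proj₂ (proj₂ (proj₂ isTNorm)))

  congˡ : ∀ {x x'} y → proj₁ x ≈ proj₁ x' → proj₁ (T x y) ≈ proj₁ (T x' y)
  congˡ = monotoneˡ⇒congˡ monoˡ

  congʳ : ∀ x {y y'} → proj₁ y ≈ proj₁ y' → proj₁ (T x y) ≈ proj₁ (T x y')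
  congʳ = monotoneʳ⇒congʳ monoʳ

  Txy≤x : ∀ x y → proj₁ (T x y) ≤ proj₁ x
  Txy≤x x y = trans (monoʳ x y (1C L) (maximum _)) (reflexive (identityʳ x))

  Txy≤y : ∀ x y → proj₁ (T x y) ≤ proj₁ y
  Txy≤y x y = trans (reflexive (comm x y)) (Txy≤x y x)

  Txy≤x∧y : ∀ x y → proj₁ (T x y) ≤ proj₁ x ∧ proj₁ y
  Txy≤x∧y x y = ∧-greatest (Txy≤x x y) (Txy≤y x y)

  IdempotentAtom : Carrier → Set (a ⊔ ℓ₁ ⊔ ℓ₂)
  IdempotentAtom z = IsAtom L z × Σ[ x ∈ C L ] (proj₁ x ≈ z × proj₁ (T x x) ≈ proj₁ x)

  α : Pred Carrier a
  α z = Resized a (IdempotentAtom z)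

  α-atomSet : AtomSet L α
  α-atomSet = (λ _ → proj₁ ∘ unresize) , closed
    where
    closed : ∀ x y → x ≈ y → α x → α y
    closed x y x≈y αx with unresize αx
    ... | x-atom , w , w≈x , Tww≈w = resize (IsAtom-resp-≈ x≈y x-atom , w , Eq.trans w≈x x≈y , Tww≈w)

  top-case : ∀ x y → (proj₁ x ≈ ⊤ ⊎ proj₁ y ≈ ⊤) → proj₁ (T x y) ≈ proj₁ x ∧ proj₁ y
  top-case x y (inj₁ x≈⊤) = begin
    proj₁ (T x y)      ≈⟨ congˡ y x≈⊤ ⟩
    proj₁ (T (1C L) y) ≈⟨ comm (1C L) y ⟩
    proj₁ (T y (1C L)) ≈⟨ identityʳ y ⟩
    proj₁ y            ≈⟨ ∧-identityˡ-≈⊤ x≈⊤ ⟨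
    proj₁ x ∧ proj₁ y  ∎
    where open import Relation.Binary.Reasoning.Setoid setoid
  top-case x y (inj₂ y≈⊤) =
    Eq.trans (congʳ x y≈⊤) (Eq.trans (identityʳ x) (Eq.sym (∧-identityʳ-≈⊤ y≈⊤)))

  idempotent-case : ∀ x y → (proj₁ x ≈ proj₁ y × α (proj₁ x)) → proj₁ (T x y) ≈ proj₁ x
  idempotent-case x y (x≈y , αx) with unresize αx
  ... | _ , w , w≈x , Tww≈w = begin
    proj₁ (T x y) ≈⟨ congʳ x x≈y ⟨
    proj₁ (T x x) ≈⟨ congˡ x w≈x ⟨
    proj₁ (T w x) ≈⟨ congʳ w w≈x ⟨
    proj₁ (T w w) ≈⟨ Tww≈w ⟩
    proj₁ w       ≈⟨ w≈x ⟩
    proj₁ x       ∎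
    where open import Relation.Binary.Reasoning.Setoid setoid

  zero-case : ∀ x y → ¬ (proj₁ x ≈ ⊤ ⊎ proj₁ y ≈ ⊤) → ¬ (proj₁ x ≈ proj₁ y × α (proj₁ x)) →
              proj₁ (T x y) ≈ ⊥
  zero-case x y ¬top ¬idem with lem {P = proj₁ x ≈ proj₁ y}
  ... | no x≉y = ≤⊥⇒≈⊥ (trans (Txy≤x∧y x y)
                               (reflexive (distinct-nonTop-meet lem x y (¬top ∘ inj₁) (¬top ∘ inj₂) x≉y)))
  ... | yes x≈y with nonTop⇒atom⊎⊥ x (¬top ∘ inj₁)
  ...   | inj₂ x≈⊥ = ≤⊥⇒≈⊥ (trans (Txy≤x x y) (reflexive x≈⊥))
  ...   | inj₁ x-atom with below-atom x-atom (T x y) (Txy≤x x y)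
  ...     | inj₁ Txy≈⊥ = Txy≈⊥
  ...     | inj₂ Txy≈x = ⊥-elim (¬idem (x≈y , resize (x-atom , x , Eq.refl , Eq.trans (congʳ x x≈y) Txy≈x)))

  isTα : IsTα L α T
  isTα x y = top-case x y , idempotent-case x y , zero-case x y

module Tα⇒TNorm (lem : ∀ {p} → ExcludedMiddle p) {a ℓ₁ ℓ₂ : Level} (L : BoundedLattice a ℓ₁ ℓ₂)
                (T : C L → C L → C L) (α : Pred (BoundedLattice.Carrier L) a)
                (α-atomSet : AtomSet L α) (isTα : IsTα L α T) where
  open BoundedLattice L
  open import Relation.Binary.Lattice.Properties.MeetSemilattice meetSemilattice using (∧-comm)
  open HeightTwo L
  open Operation L T

  HasTop : C L → C L → Set ℓ₁
  HasTop x y = proj₁ x ≈ ⊤ ⊎ proj₁ y ≈ ⊤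

  EqualInα : C L → C L → Set (a ⊔ ℓ₁)
  EqualInα x y = proj₁ x ≈ proj₁ y × α (proj₁ x)

  EqualInα-sym : ∀ x y → EqualInα x y → EqualInα y x
  EqualInα-sym _ _ (x≈y , αx) = Eq.sym x≈y , proj₂ α-atomSet _ _ x≈y αx

  private
    top-case : ∀ x y → HasTop x y → proj₁ (T x y) ≈ proj₁ x ∧ proj₁ y
    top-case x y = proj₁ (isTα x y)

    idempotent-case : ∀ x y → EqualInα x y → proj₁ (T x y) ≈ proj₁ x
    idempotent-case x y = proj₁ (proj₂ (isTα x y))

    zero-case : ∀ x y → ¬ HasTop x y → ¬ EqualInα x y → proj₁ (T x y) ≈ ⊥
    zero-case x y = proj₂ (proj₂ (isTα x y))

  identityˡ-≈⊤ : ∀ x y → proj₁ x ≈ ⊤ → proj₁ (T x y) ≈ proj₁ y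
  identityˡ-≈⊤ x y x≈⊤ = Eq.trans (top-case x y (inj₁ x≈⊤)) (∧-identityˡ-≈⊤ x≈⊤)

  identityʳ-≈⊤ : ∀ x y → proj₁ y ≈ ⊤ → proj₁ (T x y) ≈ proj₁ x
  identityʳ-≈⊤ x y y≈⊤ = Eq.trans (top-case x y (inj₂ y≈⊤)) (∧-identityʳ-≈⊤ y≈⊤)

  Txy≤x : ∀ x y → proj₁ (T x y) ≤ proj₁ x
  Txy≤x x y with lem {P = HasTop x y}
  ... | yes top = trans (reflexive (top-case x y top)) (x∧y≤x _ _)
  ... | no ¬top with lem {P = EqualInα x y}
  ...   | yes x≈y∈α = reflexive (idempotent-case x y x≈y∈α)
  ...   | no ¬x≈y∈α = ≈⊥⇒≤ (zero-case x y ¬top ¬x≈y∈α)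

  Txy≤y : ∀ x y → proj₁ (T x y) ≤ proj₁ y
  Txy≤y x y with lem {P = HasTop x y}
  ... | yes top = trans (reflexive (top-case x y top)) (x∧y≤y _ _)
  ... | no ¬top with lem {P = EqualInα x y}
  ...   | yes x≈y∈α = reflexive (Eq.trans (idempotent-case x y x≈y∈α) (proj₁ x≈y∈α))
  ...   | no ¬x≈y∈α = ≈⊥⇒≤ (zero-case x y ¬top ¬x≈y∈α)

  zeroˡ : ∀ x y → proj₁ x ≈ ⊥ → proj₁ (T x y) ≈ ⊥
  zeroˡ x y x≈⊥ = ≤⊥⇒≈⊥ (trans (Txy≤x x y) (reflexive x≈⊥))

  zeroʳ : ∀ x y → proj₁ y ≈ ⊥ → proj₁ (T x y) ≈ ⊥
  zeroʳ x y y≈⊥ = ≤⊥⇒≈⊥ (trans (Txy≤y x y) (reflexive y≈⊥))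

  monoˡ : Monotoneˡ
  monoˡ x x' y x≤x' with lem {P = proj₁ x' ≈ ⊤}
  ... | yes x'≈⊤ = trans (Txy≤y x y) (reflexive (Eq.sym (identityˡ-≈⊤ x' y x'≈⊤)))
  ... | no x'≉⊤ with lem {P = proj₁ y ≈ ⊤}
  ...   | yes y≈⊤ = trans (reflexive (identityʳ-≈⊤ x y y≈⊤))
                          (trans x≤x' (reflexive (Eq.sym (identityʳ-≈⊤ x' y y≈⊤))))
  ...   | no y≉⊤ with lem {P = EqualInα x y}
  ...     | no ¬x≈y∈α = ≈⊥⇒≤ (zero-case x y [ x≉⊤ , y≉⊤ ] ¬x≈y∈α)
    where
    x≉⊤ : ¬ proj₁ x ≈ ⊤
    x≉⊤ x≈⊤ = x'≉⊤ (⊤≤⇒≈⊤ (trans (reflexive (Eq.sym x≈⊤)) x≤x'))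
  ...     | yes (x≈y , αx) = trans (reflexive (idempotent-case x y (x≈y , αx)))
                                   (trans x≤x' (reflexive (Eq.sym (idempotent-case x' y x'≈y∈α))))
    where
    x≈x' : proj₁ x ≈ proj₁ x'
    x≈x' = atom-below-nonTop (proj₁ α-atomSet _ αx) x' x'≉⊤ x≤x'
    x'≈y∈α : EqualInα x' y
    x'≈y∈α = Eq.trans (Eq.sym x≈x') x≈y , proj₂ α-atomSet _ _ x≈x' αx

  comm : ∀ x y → proj₁ (T x y) ≈ proj₁ (T y x)
  comm x y with lem {P = HasTop x y}
  ... | yes top = Eq.trans (top-case x y top) (Eq.trans (∧-comm _ _) (Eq.sym (top-case y x (swap top))))
  ... | no ¬top with lem {P = EqualInα x y}
  ...   | yes x≈y∈α = Eq.trans (idempotent-case x y x≈y∈α)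
                        (Eq.trans (proj₁ x≈y∈α) (Eq.sym (idempotent-case y x (EqualInα-sym x y x≈y∈α))))
  ...   | no ¬x≈y∈α = Eq.trans (zero-case x y ¬top ¬x≈y∈α)
                        (Eq.sym (zero-case y x (¬top ∘ swap) (¬x≈y∈α ∘ EqualInα-sym y x)))

  monoʳ : Monotoneʳ
  monoʳ = commutative∧monotoneˡ⇒monotoneʳ comm monoˡ

  congˡ : ∀ {x x'} y → proj₁ x ≈ proj₁ x' → proj₁ (T x y) ≈ proj₁ (T x' y)
  congˡ = monotoneˡ⇒congˡ monoˡ

  congʳ : ∀ x {y y'} → proj₁ y ≈ proj₁ y' → proj₁ (T x y) ≈ proj₁ (T x y')
  congʳ = monotoneʳ⇒congʳ monoʳ

  assoc : ∀ x y z → proj₁ (T (T x y) z) ≈ proj₁ (T x (T y z))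
  assoc x y z with lem {P = proj₁ x ≈ ⊤}
  ... | yes x≈⊤ = Eq.trans (congˡ z (identityˡ-≈⊤ x y x≈⊤)) (Eq.sym (identityˡ-≈⊤ x (T y z) x≈⊤))
  ... | no x≉⊤ with lem {P = proj₁ z ≈ ⊤}
  ...   | yes z≈⊤ = Eq.trans (identityʳ-≈⊤ (T x y) z z≈⊤) (congʳ x (Eq.sym (identityʳ-≈⊤ y z z≈⊤)))
  ...   | no z≉⊤ with lem {P = proj₁ y ≈ ⊤}
  ...     | yes y≈⊤ = Eq.trans (congˡ z (identityʳ-≈⊤ x y y≈⊤)) (congʳ x (Eq.sym (identityˡ-≈⊤ y z y≈⊤)))
  ...     | no y≉⊤ with lem {P = EqualInα x y} | lem {P = EqualInα y z}
  ...       | yes x≈y∈α@(x≈y , αx) | yes (y≈z , _) = begin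
    proj₁ (T (T x y) z) ≈⟨ congˡ z (idempotent-case x y x≈y∈α) ⟩
    proj₁ (T x z)       ≈⟨ idempotent-case x z (Eq.trans x≈y y≈z , αx) ⟩
    proj₁ x             ≈⟨ idempotent-case x y x≈y∈α ⟨
    proj₁ (T x y)       ≈⟨ congʳ x (idempotent-case y z (y≈z , proj₂ α-atomSet _ _ x≈y αx)) ⟨
    proj₁ (T x (T y z)) ∎
    where open import Relation.Binary.Reasoning.Setoid setoid
  ...       | yes x≈y∈α@(x≈y , αx) | no ¬y≈z∈α = begin
    proj₁ (T (T x y) z) ≈⟨ congˡ z (idempotent-case x y x≈y∈α) ⟩
    proj₁ (T x z)       ≈⟨ zero-case x z [ x≉⊤ , z≉⊤ ] ¬x≈z∈α ⟩
    ⊥                   ≈⟨ zeroʳ x (T y z) (zero-case y z [ y≉⊤ , z≉⊤ ] ¬y≈z∈α) ⟨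
    proj₁ (T x (T y z)) ∎
    where
    open import Relation.Binary.Reasoning.Setoid setoid
    ¬x≈z∈α : ¬ EqualInα x z
    ¬x≈z∈α (x≈z , _) = ¬y≈z∈α (Eq.trans (Eq.sym x≈y) x≈z , proj₂ α-atomSet _ _ x≈y αx)
  ...       | no ¬x≈y∈α | yes y≈z∈α = begin
    proj₁ (T (T x y) z) ≈⟨ zeroˡ (T x y) z (zero-case x y [ x≉⊤ , y≉⊤ ] ¬x≈y∈α) ⟩
    ⊥                   ≈⟨ zero-case x y [ x≉⊤ , y≉⊤ ] ¬x≈y∈α ⟨
    proj₁ (T x y)       ≈⟨ congʳ x (idempotent-case y z y≈z∈α) ⟨
    proj₁ (T x (T y z)) ∎
    where open import Relation.Binary.Reasoning.Setoid setoid
  ...       | no ¬x≈y∈α | no ¬y≈z∈α =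
    Eq.trans (zeroˡ (T x y) z (zero-case x y [ x≉⊤ , y≉⊤ ] ¬x≈y∈α))
             (Eq.sym (zeroʳ x (T y z) (zero-case y z [ y≉⊤ , z≉⊤ ] ¬y≈z∈α)))

  isTNorm : IsTNorm L T
  isTNorm = monoˡ , monoʳ , comm , assoc , λ x → identityʳ-≈⊤ x (1C L) Eq.refl

theorem3p1 : (lem : ∀ {p} → ExcludedMiddle p) →
    {a ℓ₁ ℓ₂ : Level} (L : BoundedLattice a ℓ₁ ℓ₂) → Atomistic L →
    (T : C L → C L → C L) →
    (IsTNorm L T → Σ[ α ∈ Pred (BoundedLattice.Carrier L) a ] (AtomSet L α × IsTα L α T))
    × (Σ[ α ∈ Pred (BoundedLattice.Carrier L) a ] (AtomSet L α × IsTα L α T) → IsTNorm L T)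
theorem3p1 lem L _ T =
  (λ isTNorm → let open TNorm⇒Tα lem L T isTNorm in α , α-atomSet , isTα) ,
  (λ (α , α-atomSet , isTα) → Tα⇒TNorm.isTNorm lem L T α α-atomSet isTα)
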